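{- Let $n$ be an odd squarefree integer, $p'$ a prime divisor of $n$, and $A=L(n;p')$. Let $S=(x_1,\ldots,x_l)$ be a sequence in $\mathbb{Z}_n$ such that for every prime divisor $p$ of $n$, at least two terms of $S$ are coprime to $p$. Let $n'=n/p'$ and let $S'$ be the image of $S$ under the natural map $\mathbb{Z}_n\to\mathbb{Z}_{n'}$. Suppose at most one term of $S'$ is a unit. Then $S$ is an $A$-weighted zero-sum sequence.
   Context: $\mathbb{Z}_m=\mathbb{Z}/m\mathbb{Z}$, $U(m)$ its unit group; the natural map $\mathbb{Z}_n\to\mathbb{Z}_{n'}$ is reduction modulo $n'$. For $A\subseteq\mathbb{Z}_n$, a sequence $(x_1,\ldots,x_l)$ is an $A$-weighted zero-sum sequence if $a_1x_1+\cdots+a_lx_l=0$ for some $a_i\in A$. For odd $n=\prod p_i^{r_i}$ and $a\in U(n)$, $\left(\frac{a}{n}\right)=\prod_i\left(\frac{a\bmod p_i}{p_i}\right)^{r_i}$, and $\left(\frac{a}{p}\right)$ is the Legendre symbol of $a\bmod p$. $L(n;p')=\{a\in U(n): \left(\frac{a}{n}\right)=\left(\frac{a}{p'}\right)\}$. -}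

module Defs where

open import Data.Nat using (ℕ; zero; suc; _+_; _*_; _^_; _<_; _≡ᵇ_)
open import Data.Nat.DivMod using (_%_)
open import Data.Nat.Divisibility using (_∣_; _∣?_)
open import Data.Nat.Primality using (Prime; prime?)
open import Data.Nat.Coprimality using (Coprime)
open import Data.Bool using (Bool; true; false; if_then_else_)
open import Data.List using (List; upTo; map; foldr; concatMap)
open import Data.Bool.ListAction using (any)
open import Data.Integer using (ℤ; 1ℤ; -1ℤ) renaming (_*_ to _*ℤ_)
open import Data.Fin using (Fin; toℕ; zero; suc)
open import Data.Product using (_×_)
open import Relation.Nullary.Decidable using (does; _×-dec_)
open import Relation.Binary.PropositionalEquality using (_≡_)

-- reduction of a natural number modulo m (modulo 0 is the identity; unused)
_mod_ : ℕ → ℕ → ℕ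
a mod zero = a
a mod suc m = a % suc m

isQR : ℕ → ℕ → Bool
isQR a p = any (λ x → (x * x) mod p ≡ᵇ a mod p) (upTo p)

-- Legendre symbol (a/p) for a coprime to the prime p : +1 if QR, -1 otherwise
legendre : ℕ → ℕ → ℤ
legendre a p = if isQR a p then 1ℤ else -1ℤ

-- Jacobi symbol (a/n) = ∏_{p prime, p^r ∥ n} (a/p)^r,
-- realised as the product of (a/p) over all pairs (p , k) with p prime, k ≥ 1,
-- p^k ∣ n (for n ≥ 1 there are exactly r such k for each p).
jacobi : ℕ → ℕ → ℤ
jacobi a n = foldr _*ℤ_ 1ℤ
  (concatMap (λ p → map (λ k → if does (prime? p ×-dec ((p ^ suc k) ∣? n))
                                 then legendre a p else 1ℤ)
                        (upTo n))
             (upTo (suc n)))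

-- the unit group U(n), elements of ℤ_n represented by 0 ≤ a < n
U : ℕ → ℕ → Set
U n a = (a < n) × Coprime a n

L : ℕ → ℕ → ℕ → Set
L n p' a = U n a × (jacobi a n ≡ legendre a p')

sumF : (l : ℕ) → (Fin l → ℕ) → ℕ
sumF zero f = 0
sumF (suc l) f = f zero + sumF l (λ i → f (suc i))

WeightedZeroSum : (n : ℕ) → (A : ℕ → Set) → (l : ℕ) → (Fin l → Fin n) → Set
WeightedZeroSum n A l x =
  Data.Product.Σ (Fin l → ℕ) λ a →
    ((i : Fin l) → A (a i)) × (sumF l (λ i → a i * toℕ (x i)) mod n ≡ 0)

SquareFree : ℕ → Set
SquareFree n = (p : ℕ) → Prime p → p * p ∣ n → Data.Empty.⊥
  where import Data.Empty

-- The weights are built one prime q ∣ n at a time and glued by the Chinese remainder theorem,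
-- which applies because n is squarefree. For each q, the two terms of S that are prime to q
-- give weights prime to q with Σ wᵢ xᵢ ≡ 0 (mod q); if moreover q ≠ p′ and some x_c is a unit
-- of ℤ_{n′} (by hypothesis there is at most one), the weight of x_c can be taken to be 1.
-- Gluing gives weights wᵢ ∈ U(n). When xᵢ is a unit of ℤ_{n′}, wᵢ ≡ 1 modulo every prime of n′,
-- so (wᵢ/n) = (wᵢ/p′). Otherwise some prime r ∣ n′ divides xᵢ, so wᵢ mod r does not affect
-- wᵢ xᵢ; switching it between a residue and a nonresidue mod r (r is odd) flips (wᵢ/n) but not
-- (wᵢ/p′), and one of the two choices puts wᵢ in L(n;p′).
module Submission where

open import Algebra.Properties.CommutativeSemigroup using (x∙yz≈y∙xz)
open import Data.Bool using (T; true; false; if_then_else_)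
open import Data.Bool.ListAction using (any)
open import Data.Empty using (⊥)
open import Data.Fin using (Fin; toℕ; fromℕ<) renaming (zero to fzero; suc to fsuc)
open import Data.Fin.Instances
open import Data.Fin.Properties using (any?; pigeonhole; toℕ-injective; toℕ<n; toℕ-fromℕ<)
import Data.Fin.Properties as Fin
open import Data.Integer using (ℤ; 1ℤ; -1ℤ)
import Data.Integer as ℤ
import Data.Integer.Properties as ℤ
open import Data.List using (List; []; _∷_; _++_; map; foldr; concatMap; applyUpTo; upTo)
open import Data.List.Membership.Propositional using (lose; find)
open import Data.List.Membership.Propositional.Properties using (∈-upTo⁺; ∈-upTo⁻)
open import Data.List.Relation.Unary.All using (_∷_)
open import Data.List.Relation.Unary.Any.Properties using (any⁺; any⁻)
open import Data.Nat
  using (ℕ; zero; suc; _+_; _*_; _∸_; _^_; _<_; _≤_; z≤n; s≤s; z<s; pred; _≡ᵇ_; _%_; _/_;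
         NonZero; ≢-nonZero; ≢-nonZero⁻¹; >-nonZero⁻¹; nonTrivial⇒≢1; nonTrivial⇒n>1)
open import Data.Nat.Coprimality using (Coprime; coprime?; coprime-Bézout; gcd≡1⇒coprime)
open import Data.Nat.Divisibility
  using (_∣_; _∣?_; divides; ∣-refl; ∣-trans; _∣0; 1∣_; 0∣⇒≡0; ∣1⇒≡1; ∣⇒≤; m∣m*n; n∣m*n;
         ∣m⇒∣m*n; ∣n⇒∣m*n; ∣m+n∣m⇒∣n; *-pres-∣; *-monoʳ-∣; quotient-∣; quotient-<; quotient≢0;
         m%n≡0⇒n∣m; n∣m⇒m%n≡0; %-presˡ-∣; ∣n∣m%n⇒∣m)
open import Data.Nat.DivMod
  using (%-distribˡ-+; %-distribˡ-*; [m+kn]%n≡m%n; %-remove-+ˡ; m%n<n; m<n⇒m%n≡m;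
         m∣n⇒o%n%m≡o%m; m≡m%n+[m/n]*n)
open import Data.Nat.GCD using (gcd[m,n]∣m; gcd[m,n]∣n; module Bézout)
open import Data.Nat.Induction using (<-rec)
import Data.Nat.ListAction as ℕ
open import Data.Nat.Instances
open import Data.Nat.Primality
  using (Prime; prime?; prime[2]; prime⇒nonZero; prime⇒nonTrivial; prime⇒irreducible; euclidsLemma)
open import Data.Nat.Primality.Factorisation using (factorise)
open import Data.Nat.Properties
  using (+-comm; +-assoc; +-identityʳ; *-identityˡ; *-identityʳ; *-comm; *-zeroʳ; *-distribˡ-+;
         +-commutativeSemigroup; m*n≢0⇒m≢0; ≡ᵇ⇒≡; ≡⇒≡ᵇ; _≤?_; ≤-trans; ≤-reflexive; <⇒≤; ≰⇒>;
         ∸-monoʳ-≤; m+n∸m≡n; m∸n+n≡m; m<m+n)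
open import Data.Nat.Tactic.RingSolver using (solve-∀)
open import Data.Product using (Σ; _×_; _,_; proj₁; proj₂; ∃-syntax)
open import Data.Sum using (_⊎_; inj₁; inj₂)
open import Defs
open import Function using (_∘_; id)
open import Relation.Binary.PropositionalEquality
open import Relation.Binary.Structures using (IsDecEquivalence)
open import Relation.Binary.TypeClasses using (_≟_)
open import Relation.Nullary using (¬_; Dec; yes; no; does; contradiction)
open import Relation.Nullary.Decidable using (T?; ¬?; _×-dec_; decidable-stable)
open import Relation.Unary using (Decidable)

open ≡-Reasoning

-- Congruences

mod-+ : ∀ {a b c d} q → a mod q ≡ b mod q → c mod q ≡ d mod q → (a + c) mod q ≡ (b + d) mod q
mod-+ zero a≡b c≡d = cong₂ _+_ a≡b c≡d
mod-+ {a} {b} {c} {d} (suc q) a≡b c≡d = begin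
  (a + c) % suc q                   ≡⟨ %-distribˡ-+ a c (suc q) ⟩
  (a % suc q + c % suc q) % suc q   ≡⟨ cong₂ (λ u v → (u + v) % suc q) a≡b c≡d ⟩
  (b % suc q + d % suc q) % suc q   ≡⟨ %-distribˡ-+ b d (suc q) ⟨
  (b + d) % suc q                   ∎

mod-*ʳ : ∀ {a b} q c → a mod q ≡ b mod q → (a * c) mod q ≡ (b * c) mod q
mod-*ʳ zero c a≡b = cong (_* c) a≡b
mod-*ʳ {a} {b} (suc q) c a≡b = begin
  (a * c) % suc q                   ≡⟨ %-distribˡ-* a c (suc q) ⟩
  (a % suc q * (c % suc q)) % suc q ≡⟨ cong (λ u → (u * (c % suc q)) % suc q) a≡b ⟩
  (b % suc q * (c % suc q)) % suc q ≡⟨ %-distribˡ-* b c (suc q) ⟨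
  (b * c) % suc q                   ∎

∣-resp-mod : ∀ {a b} q → a mod q ≡ b mod q → q ∣ b → q ∣ a
∣-resp-mod zero a≡b 0∣b = subst (0 ∣_) (sym a≡b) 0∣b
∣-resp-mod {a} {b} (suc q) a≡b q∣b = m%n≡0⇒n∣m a (suc q) (trans a≡b (n∣m⇒m%n≡0 b (suc q) q∣b))

∣⇒mod≡0 : ∀ {a} q → q ∣ a → a mod q ≡ 0
∣⇒mod≡0 zero 0∣a = 0∣⇒≡0 0∣a
∣⇒mod≡0 {a} (suc q) q∣a = n∣m⇒m%n≡0 a (suc q) q∣a

mod-mod-∣ : ∀ a {q} n → q ∣ n → (a mod n) mod q ≡ a mod q
mod-mod-∣ a zero _ = refl
mod-mod-∣ a {zero} (suc n) 0∣n = contradiction (0∣⇒≡0 0∣n) λ ()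
mod-mod-∣ a {suc q} (suc n) q∣n = m∣n⇒o%n%m≡o%m (suc q) (suc n) a q∣n

mod-∣ : ∀ {a b q} n → a mod n ≡ b mod n → q ∣ n → a mod q ≡ b mod q
mod-∣ {a} {b} {q} n a≡b q∣n = begin
  a mod q         ≡⟨ mod-mod-∣ a n q∣n ⟨
  (a mod n) mod q ≡⟨ cong (_mod q) a≡b ⟩
  (b mod n) mod q ≡⟨ mod-mod-∣ b n q∣n ⟩
  b mod q         ∎

∣⇒∣-mod : ∀ {q x} n → q ∣ n → q ∣ x → q ∣ x mod n
∣⇒∣-mod zero _ q∣x = q∣x
∣⇒∣-mod (suc n) q∣n q∣x = %-presˡ-∣ q∣x q∣n

∣-mod⇒∣ : ∀ {q x} n → q ∣ n → q ∣ x mod n → q ∣ x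
∣-mod⇒∣ zero _ q∣x = q∣x
∣-mod⇒∣ (suc n) q∣n q∣x%n = ∣n∣m%n⇒∣m q∣n q∣x%n

mod-< : ∀ a n .{{_ : NonZero n}} → a mod n < n
mod-< a (suc n) = m%n<n a (suc n)

mod-id : ∀ {a n} → a < n → a mod n ≡ a
mod-id {n = suc n} a<n = m<n⇒m%n≡m a<n

[μ*m+b]mod-m : ∀ μ m b → (μ * m + b) mod m ≡ b mod m
[μ*m+b]mod-m μ zero b = cong (_+ b) (*-zeroʳ μ)
[μ*m+b]mod-m μ (suc m) b = trans (cong (_% suc m) (+-comm (μ * suc m) b)) ([m+kn]%n≡m%n b μ (suc m))

-- Adding (q - 1) t is subtracting t modulo q, without leaving ℕ.
∣[a+pred-q*t]⇒mod : ∀ {a t} q .{{_ : NonZero q}} → q ∣ a + pred q * t → a mod q ≡ t mod q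
∣[a+pred-q*t]⇒mod {a} {t} (suc k) q∣ = begin
  a % suc k               ≡⟨ [m+kn]%n≡m%n a t (suc k) ⟨
  (a + t * suc k) % suc k ≡⟨ cong (_% suc k) (regroup a t k) ⟩
  (a + k * t + t) % suc k ≡⟨ %-remove-+ˡ t q∣ ⟩
  t % suc k               ∎
  where
  regroup : ∀ a t k → a + t * suc k ≡ a + k * t + t
  regroup = solve-∀

coprime⇒∣-solvable : ∀ {a q} .{{_ : NonZero q}} → Coprime a q → ∀ e → ∃[ μ ] q ∣ μ * a + e
coprime⇒∣-solvable {a} {suc k} coprime e with coprime-Bézout coprime
... | Bézout.-+ x y 1+xa≡yq = x * e , divides (y * e) (begin
  x * e * a + e       ≡⟨ factor x e a ⟩
  (1 + x * a) * e     ≡⟨ cong (_* e) 1+xa≡yq ⟩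
  y * suc k * e       ≡⟨ swap y (suc k) e ⟩
  y * e * suc k       ∎)
  where
  factor : ∀ x e a → x * e * a + e ≡ (1 + x * a) * e
  factor = solve-∀
  swap : ∀ y q e → y * q * e ≡ y * e * q
  swap = solve-∀
... | Bézout.+- x y 1+yq≡xa = x * (k * e) , divides (e + y * k * e) (begin
  x * (k * e) * a + e           ≡⟨ regroup x k e a ⟩
  x * a * (k * e) + e           ≡⟨ cong (λ z → z * (k * e) + e) 1+yq≡xa ⟨
  (1 + y * suc k) * (k * e) + e ≡⟨ factor y k e ⟩
  (e + y * k * e) * suc k       ∎)
  where
  regroup : ∀ x k e a → x * (k * e) * a + e ≡ x * a * (k * e) + e
  regroup = solve-∀
  factor : ∀ y k e → (1 + y * suc k) * (k * e) + e ≡ (e + y * k * e) * suc k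
  factor = solve-∀

coprime⇒solvable : ∀ {a q} .{{_ : NonZero q}} → Coprime a q → ∀ b t → ∃[ μ ] (μ * a + b) mod q ≡ t mod q
coprime⇒solvable {a} {q} coprime b t =
  let μ , q∣ = coprime⇒∣-solvable coprime (b + pred q * t)
  in μ , ∣[a+pred-q*t]⇒mod q (subst (q ∣_) (sym (+-assoc (μ * a) b _)) q∣)

-- Primes and squarefree moduli

prime-∣-prime : ∀ {p q} → Prime p → Prime q → p ∣ q → p ≡ q
prime-∣-prime pp pq p∣q with prime⇒irreducible pq p∣q
... | inj₁ p≡1 = contradiction p≡1 (nonTrivial⇒≢1 {{prime⇒nonTrivial pp}})
... | inj₂ p≡q = p≡q

prime-∤1 : ∀ {p} → Prime p → ¬ p ∣ 1
prime-∤1 pp p∣1 = nonTrivial⇒≢1 {{prime⇒nonTrivial pp}} (∣1⇒≡1 p∣1)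

∣m*p⇒∣m : ∀ {q p m} → Prime q → Prime p → q ≢ p → q ∣ m * p → q ∣ m
∣m*p⇒∣m {m = m} pq pp q≢p q∣mp with euclidsLemma m _ pq q∣mp
... | inj₁ q∣m = q∣m
... | inj₂ q∣p = contradiction (prime-∣-prime pq pp q∣p) q≢p

odd⇒nonZero : ∀ {n} → ¬ 2 ∣ n → NonZero n
odd⇒nonZero n-odd = ≢-nonZero λ { refl → n-odd (2 ∣0) }

odd⇒≡1+h+h : ∀ {r} → ¬ 2 ∣ r → ∃[ h ] r ≡ suc (h + h)
odd⇒≡1+h+h {r} r-odd with r % 2 | m≡m%n+[m/n]*n r 2 | m%n<n r 2
... | 0 | r≡ | _ = contradiction (divides (r / 2) r≡) r-odd
... | 1 | r≡ | _ =
  r / 2 , trans r≡ (cong suc (trans (*-comm (r / 2) 2) (cong (r / 2 +_) (+-identityʳ (r / 2)))))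
... | suc (suc _) | _ | s≤s (s≤s ())

∃-prime-divisor : ∀ {n} → 1 < n → ∃[ q ] Prime q × q ∣ n
∃-prime-divisor {suc zero} (s≤s ())
∃-prime-divisor {n@(suc (suc _))} _ with factorise n
... | record { factors = q ∷ qs ; isFactorisation = n≡q*qs ; factorsPrime = pq ∷ _ } =
  q , pq , divides (ℕ.product qs) (trans n≡q*qs (*-comm q _))

∃-prime-common-divisor : ∀ {d x n} .{{_ : NonZero n}} → d ∣ x → d ∣ n → d ≢ 1 →
  ∃[ q ] Prime q × q ∣ n × q ∣ x
∃-prime-common-divisor {zero} {n = n} _ 0∣n _ = contradiction (0∣⇒≡0 0∣n) (≢-nonZero⁻¹ n)
∃-prime-common-divisor {suc zero} _ _ d≢1 = contradiction refl d≢1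
∃-prime-common-divisor {suc (suc _)} d∣x d∣n _ =
  let q , pq , q∣d = ∃-prime-divisor (s≤s (s≤s z≤n)) in q , pq , ∣-trans q∣d d∣n , ∣-trans q∣d d∣x

coprime⇒∤ : ∀ {q x n} → Coprime x n → Prime q → q ∣ n → ¬ q ∣ x
coprime⇒∤ coprime pq q∣n q∣x = nonTrivial⇒≢1 {{prime⇒nonTrivial pq}} (coprime (q∣x , q∣n))

∤⇒coprime : ∀ {x n} .{{_ : NonZero n}} → (∀ q → Prime q → q ∣ n → ¬ q ∣ x) → Coprime x n
∤⇒coprime ∤x {d} (d∣x , d∣n) with d ≟ 1
... | yes d≡1 = d≡1
... | no d≢1 =
  let q , pq , q∣n , q∣x = ∃-prime-common-divisor d∣x d∣n d≢1 in contradiction q∣x (∤x q pq q∣n)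

¬coprime⇒∃-prime : ∀ {x n} .{{_ : NonZero n}} → ¬ Coprime x n → ∃[ q ] Prime q × q ∣ n × q ∣ x
¬coprime⇒∃-prime {x} {n} ¬coprime =
  ∃-prime-common-divisor (gcd[m,n]∣m x n) (gcd[m,n]∣n x n) (¬coprime ∘ gcd≡1⇒coprime)

prime-∤⇒coprime : ∀ {p x} → Prime p → ¬ p ∣ x → Coprime x p
prime-∤⇒coprime pp p∤x (d∣x , d∣p) with prime⇒irreducible pp d∣p
... | inj₁ d≡1 = d≡1
... | inj₂ refl = contradiction d∣x p∤x

squarefree-∣ : ∀ {m n} → SquareFree n → m ∣ n → SquareFree m
squarefree-∣ sf m∣n p pp p²∣m = sf p pp (∣-trans p²∣m m∣n)

squarefree-induction : (P : ℕ → Set) → P 1 →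
  (∀ {q m} → Prime q → ¬ q ∣ m → SquareFree m → .{{_ : NonZero m}} → P m → P (q * m)) →
  ∀ n .{{_ : NonZero n}} → SquareFree n → P n
squarefree-induction P base step = <-rec (λ n → .{{_ : NonZero n}} → SquareFree n → P n) go
  where
  go : ∀ n → (∀ {m} → m < n → .{{_ : NonZero m}} → SquareFree m → P m) →
       .{{_ : NonZero n}} → SquareFree n → P n
  go (suc zero) _ _ = base
  go n@(suc (suc _)) rec sf with q , pq , q∣n@(divides m n≡m*q) ← ∃-prime-divisor {n} (s≤s (s≤s z≤n)) =
    subst P (sym (trans n≡m*q (*-comm m q)))
      (step pq q∤m sf-m {{m≢0}} (rec (quotient-< q∣n {{prime⇒nonTrivial pq}}) {{m≢0}} sf-m))
    where
    m≢0 : NonZero m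
    m≢0 = quotient≢0 q∣n
    sf-m : SquareFree m
    sf-m = squarefree-∣ sf (quotient-∣ q∣n)
    q∤m : ¬ q ∣ m
    q∤m q∣m = sf q pq (subst (q * q ∣_) (trans (*-comm q m) (sym n≡m*q)) (*-monoʳ-∣ q q∣m))

crt-pair : ∀ {m q} .{{_ : NonZero q}} → Coprime m q → ∀ b t →
  ∃[ a ] a mod m ≡ b mod m × a mod q ≡ t mod q
crt-pair {m} coprime b t =
  let μ , a≡t = coprime⇒solvable coprime b t in μ * m + b , [μ*m+b]mod-m μ m b , a≡t

chinese-remainder : ∀ n .{{_ : NonZero n}} → SquareFree n → (r : ℕ → ℕ) →
  ∃[ a ] a < n × ∀ q → Prime q → q ∣ n → a mod q ≡ r q mod q
chinese-remainder n sf r =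
  let a , a≡r = squarefree-induction Solvable base step n sf r
  in a mod n , mod-< a n , λ q pq q∣n → trans (mod-mod-∣ a n q∣n) (a≡r q pq q∣n)
  where
  Solvable : ℕ → Set
  Solvable n = ∀ r → ∃[ a ] ∀ q → Prime q → q ∣ n → a mod q ≡ r q mod q
  base : Solvable 1
  base r = 0 , λ q pq q∣1 → contradiction q∣1 (prime-∤1 pq)
  step : ∀ {q m} → Prime q → ¬ q ∣ m → SquareFree m → .{{_ : NonZero m}} → Solvable m → Solvable (q * m)
  step {q} {m} pq q∤m _ solvable r
    with b , b≡r ← solvable r
    with a , a≡b , a≡rq ← crt-pair {{prime⇒nonZero pq}} (prime-∤⇒coprime pq q∤m) b (r q) = a , a≡r
    where
    a≡r : ∀ q′ → Prime q′ → q′ ∣ q * m → a mod q′ ≡ r q′ mod q′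
    a≡r q′ pq′ q′∣qm with euclidsLemma q m pq′ q′∣qm
    ... | inj₁ q′∣q rewrite prime-∣-prime pq′ pq q′∣q = a≡rq
    ... | inj₂ q′∣m = trans (mod-∣ m a≡b q′∣m) (b≡r q′ pq′ q′∣m)

primes-∣⇒∣ : ∀ n .{{_ : NonZero n}} → SquareFree n → ∀ {N} → (∀ q → Prime q → q ∣ n → q ∣ N) → n ∣ N
primes-∣⇒∣ n sf {N} = squarefree-induction Divides (λ _ → 1∣ N) step n sf
  where
  Divides : ℕ → Set
  Divides n = (∀ q → Prime q → q ∣ n → q ∣ N) → n ∣ N
  step : ∀ {q m} → Prime q → ¬ q ∣ m → SquareFree m → .{{_ : NonZero m}} → Divides m → Divides (q * m)
  step {q} {m} pq q∤m _ divides-m primes∣N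
    with divides o refl ← divides-m (λ q′ pq′ q′∣m → primes∣N q′ pq′ (∣-trans q′∣m (n∣m*n q)))
    with euclidsLemma o m pq (primes∣N q pq (m∣m*n m))
  ... | inj₁ q∣o = *-pres-∣ q∣o ∣-refl
  ... | inj₂ q∣m = contradiction q∣m q∤m

_[_≔_] : {A B : Set} {{_ : IsDecEquivalence {A = A} _≡_}} → (A → B) → A → B → A → B
(f [ r ≔ v ]) p = if does (p ≟ r) then v else f p

[≔]-updates : ∀ {A B : Set} {{_ : IsDecEquivalence {A = A} _≡_}} (f : A → B) r {v} → (f [ r ≔ v ]) r ≡ v
[≔]-updates f r with r ≟ r
... | yes _ = refl
... | no r≢r = contradiction refl r≢r

[≔]-minimal : ∀ {A B : Set} {{_ : IsDecEquivalence {A = A} _≡_}} {f : A → B} {r v p} →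
  p ≢ r → (f [ r ≔ v ]) p ≡ f p
[≔]-minimal {r = r} {p = p} p≢r with p ≟ r
... | yes p≡r = contradiction p≡r p≢r
... | no _ = refl

[≔]-elim : ∀ {A B : Set} {{_ : IsDecEquivalence {A = A} _≡_}} (P : A → B → Set) {f : A → B} {r v} →
  P r v → (∀ p → p ≢ r → P p (f p)) → ∀ p → P p ((f [ r ≔ v ]) p)
[≔]-elim P {r = r} Pv Pf p with p ≟ r
... | yes refl = Pv
... | no p≢r = Pf p p≢r

[≔]-cong : ∀ {A B : Set} {{_ : IsDecEquivalence {A = A} _≡_}} {f g : A → B} {r v} →
  (∀ p → p ≢ r → f p ≡ g p) → ∀ p → (f [ r ≔ v ]) p ≡ (g [ r ≔ v ]) p
[≔]-cong {r = r} f≡g p with p ≟ r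
... | yes _ = refl
... | no p≢r = f≡g p p≢r

infix 4 _≡±1
_≡±1 : ℤ → Set
s ≡±1 = s ≡ 1ℤ ⊎ s ≡ -1ℤ

*-≡±1 : ∀ {s t} → s ≡±1 → t ≡±1 → (s ℤ.* t) ≡±1
*-≡±1 (inj₁ refl) (inj₁ refl) = inj₁ refl
*-≡±1 (inj₁ refl) (inj₂ refl) = inj₂ refl
*-≡±1 (inj₂ refl) (inj₁ refl) = inj₂ refl
*-≡±1 (inj₂ refl) (inj₂ refl) = inj₁ refl

neg-≡±1 : ∀ {s} → s ≡±1 → (ℤ.- s) ≡±1
neg-≡±1 (inj₁ refl) = inj₂ refl
neg-≡±1 (inj₂ refl) = inj₁ refl

≢⇒≡neg : ∀ {s t} → s ≡±1 → t ≡±1 → s ≢ t → s ≡ ℤ.- t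
≢⇒≡neg (inj₁ refl) (inj₁ refl) s≢t = contradiction refl s≢t
≢⇒≡neg (inj₁ refl) (inj₂ refl) _ = refl
≢⇒≡neg (inj₂ refl) (inj₁ refl) _ = refl
≢⇒≡neg (inj₂ refl) (inj₂ refl) s≢t = contradiction refl s≢t

∏ : ℕ → (ℕ → ℤ) → ℤ
∏ zero h = 1ℤ
∏ (suc m) h = h 0 ℤ.* ∏ m (h ∘ suc)

∏-cong : ∀ m {h g} → (∀ p → h p ≡ g p) → ∏ m h ≡ ∏ m g
∏-cong zero _ = refl
∏-cong (suc m) h≡g = cong₂ ℤ._*_ (h≡g 0) (∏-cong m (h≡g ∘ suc))

∏-ones : ∀ m {h} → (∀ p → h p ≡ 1ℤ) → ∏ m h ≡ 1ℤ
∏-ones zero _ = refl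
∏-ones (suc m) h≡1 = cong₂ ℤ._*_ (h≡1 0) (∏-ones m (h≡1 ∘ suc))

∏-≡±1 : ∀ m {h} → (∀ p → h p ≡±1) → ∏ m h ≡±1
∏-≡±1 zero _ = inj₁ refl
∏-≡±1 (suc m) h≡±1 = *-≡±1 (h≡±1 0) (∏-≡±1 m (h≡±1 ∘ suc))

∏-split : ∀ m h {r} → r < m → ∏ m h ≡ h r ℤ.* ∏ m (h [ r ≔ 1ℤ ])
∏-split (suc m) h {zero} _ = cong (h 0 ℤ.*_) (sym (ℤ.*-identityˡ _))
∏-split (suc m) h {suc r} (s≤s r<m) = begin
  h 0 ℤ.* ∏ m (h ∘ suc)
    ≡⟨ cong (h 0 ℤ.*_) (∏-split m (h ∘ suc) r<m) ⟩
  h 0 ℤ.* (h (suc r) ℤ.* ∏ m ((h ∘ suc) [ r ≔ 1ℤ ]))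
    ≡⟨ x∙yz≈y∙xz ℤ.*-commutativeSemigroup (h 0) (h (suc r)) _ ⟩
  h (suc r) ℤ.* (h 0 ℤ.* ∏ m ((h ∘ suc) [ r ≔ 1ℤ ]))
    ∎

productℤ : List ℤ → ℤ
productℤ = foldr ℤ._*_ 1ℤ

productℤ-++ : ∀ xs ys → productℤ (xs ++ ys) ≡ productℤ xs ℤ.* productℤ ys
productℤ-++ [] ys = sym (ℤ.*-identityˡ _)
productℤ-++ (x ∷ xs) ys = trans (cong (x ℤ.*_) (productℤ-++ xs ys)) (sym (ℤ.*-assoc x _ _))

productℤ-map-applyUpTo : ∀ {A : Set} (h : A → ℤ) f m → productℤ (map h (applyUpTo f m)) ≡ ∏ m (h ∘ f)
productℤ-map-applyUpTo h f zero = refl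
productℤ-map-applyUpTo h f (suc m) = cong (h (f 0) ℤ.*_) (productℤ-map-applyUpTo h (f ∘ suc) m)

productℤ-concatMap-applyUpTo : ∀ {A : Set} (F : A → List ℤ) f m →
  productℤ (concatMap F (applyUpTo f m)) ≡ ∏ m (productℤ ∘ F ∘ f)
productℤ-concatMap-applyUpTo F f zero = refl
productℤ-concatMap-applyUpTo F f (suc m) = trans (productℤ-++ (F (f 0)) _)
  (cong (productℤ (F (f 0)) ℤ.*_) (productℤ-concatMap-applyUpTo F (f ∘ suc) m))

-- The Legendre symbol

legendre-cong : ∀ {a b} p → a mod p ≡ b mod p → legendre a p ≡ legendre b p
legendre-cong p a≡b = cong (λ v → if any (λ x → (x * x) mod p ≡ᵇ v) (upTo p) then 1ℤ else -1ℤ) a≡b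

legendre≡±1 : ∀ a p → legendre a p ≡±1
legendre≡±1 a p with isQR a p
... | true = inj₁ refl
... | false = inj₂ refl

isQR⁺ : ∀ {a p x} → x < p → (x * x) mod p ≡ a mod p → T (isQR a p)
isQR⁺ x<p x²≡a = any⁺ _ (lose (∈-upTo⁺ x<p) (≡⇒≡ᵇ _ _ x²≡a))

isQR⁻ : ∀ {a p} → T (isQR a p) → ∃[ x ] x < p × (x * x) mod p ≡ a mod p
isQR⁻ qr = let x , x∈ , x²≡a = find (any⁻ _ _ qr) in x , ∈-upTo⁻ x∈ , ≡ᵇ⇒≡ _ _ x²≡a

legendre-residue : ∀ {a p} → T (isQR a p) → legendre a p ≡ 1ℤ
legendre-residue {a} {p} qr with isQR a p
... | true = refl

legendre-nonresidue : ∀ {a p} → ¬ T (isQR a p) → legendre a p ≡ -1ℤ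
legendre-nonresidue {a} {p} nqr with isQR a p
... | true = contradiction _ nqr
... | false = refl

legendre-1 : ∀ {p} → Prime p → legendre 1 p ≡ 1ℤ
legendre-1 {p} pp =
  legendre-residue {1} {p} (isQR⁺ {1} {p} (nonTrivial⇒n>1 p {{prime⇒nonTrivial pp}}) refl)

[r∸x]²≡x² : ∀ r x → x ≤ r → ((r ∸ x) * (r ∸ x)) mod r ≡ (x * x) mod r
[r∸x]²≡x² zero .zero z≤n = refl
[r∸x]²≡x² r@(suc _) x x≤r = begin
  (y * y) % r               ≡⟨ [m+kn]%n≡m%n (y * y) x r ⟨
  (y * y + x * r) % r       ≡⟨ cong (λ z → (y * y + x * z) % r) y+x≡r ⟨
  (y * y + x * (y + x)) % r ≡⟨ cong (_% r) (regroup y x) ⟩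
  (x * x + y * (y + x)) % r ≡⟨ cong (λ z → (x * x + y * z) % r) y+x≡r ⟩
  (x * x + y * r) % r       ≡⟨ [m+kn]%n≡m%n (x * x) y r ⟩
  (x * x) % r               ∎
  where
  y = r ∸ x
  y+x≡r : y + x ≡ r
  y+x≡r = m∸n+n≡m x≤r
  regroup : ∀ y x → y * y + x * (y + x) ≡ x * x + y * (y + x)
  regroup = solve-∀

∃-root-≤-half : ∀ {r h x} → r ≡ suc (h + h) → x < r → ∃[ y ] y ≤ h × (y * y) mod r ≡ (x * x) mod r
∃-root-≤-half {r} {h} {x} r≡ x<r with x ≤? h
... | yes x≤h = x , x≤h , refl
... | no x≰h = r ∸ x , r∸x≤h , [r∸x]²≡x² r x (<⇒≤ x<r)
  where
  r∸x≤h : r ∸ x ≤ h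
  r∸x≤h = ≤-trans (∸-monoʳ-≤ r (≰⇒> x≰h)) (≤-reflexive (trans (cong (_∸ suc h) r≡) (m+n∸m≡n h h)))

all-squares⇒injection : ∀ {r h} → r ≡ suc (h + h) → (∀ (c : Fin r) → T (isQR (toℕ c) r)) →
  Σ (Fin r → Fin (suc h)) λ f → ∀ i j → f i ≡ f j → i ≡ j
all-squares⇒injection {r} {h} r≡ all-qr = root , root-injective
  where
  small-root : ∀ (c : Fin r) → ∃[ y ] y ≤ h × (y * y) mod r ≡ toℕ c mod r
  small-root c =
    let x , x<r , x²≡c = isQR⁻ {toℕ c} {r} (all-qr c)
        y , y≤h , y²≡x² = ∃-root-≤-half r≡ x<r
    in y , y≤h , trans y²≡x² x²≡c
  y : Fin r → ℕ
  y c = proj₁ (small-root c)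
  root : Fin r → Fin (suc h)
  root c = fromℕ< (s≤s (proj₁ (proj₂ (small-root c))))
  root-injective : ∀ i j → root i ≡ root j → i ≡ j
  root-injective i j root[i]≡root[j] = toℕ-injective (begin
    toℕ i                 ≡⟨ mod-id (toℕ<n i) ⟨
    toℕ i mod r           ≡⟨ proj₂ (proj₂ (small-root i)) ⟨
    (y i * y i) mod r     ≡⟨ cong (λ z → (z * z) mod r) y[i]≡y[j] ⟩
    (y j * y j) mod r     ≡⟨ proj₂ (proj₂ (small-root j)) ⟩
    toℕ j mod r           ≡⟨ mod-id (toℕ<n j) ⟩
    toℕ j                 ∎)
    where
    y[i]≡y[j] : y i ≡ y j
    y[i]≡y[j] = trans (sym (toℕ-fromℕ< _)) (trans (cong toℕ root[i]≡root[j]) (toℕ-fromℕ< _))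

∃-nonresidue : ∀ {r} → 1 < r → ¬ 2 ∣ r → ∃[ c ] ¬ T (isQR c r)
∃-nonresidue {r} 1<r r-odd with any? {n = r} (λ c → ¬? (T? (isQR (toℕ c) r)))
... | yes (c , nqr) = toℕ c , nqr
... | no all-qr =
  let h , r≡ = odd⇒≡1+h+h r-odd
      f , f-injective = all-squares⇒injection r≡ (λ c → decidable-stable (T? _) (all-qr ∘ (c ,_)))
      i , j , i<j , f[i]≡f[j] = pigeonhole (h<r {h = h} 1<r r≡) f
  in contradiction (f-injective i j f[i]≡f[j]) (Fin.<⇒≢ i<j)
  where
  h<r : ∀ {r h} → 1 < r → r ≡ suc (h + h) → suc h < r
  h<r {h = zero} (s≤s ()) refl
  h<r {h = suc h} _ refl = s≤s (m<m+n (suc h) z<s)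

legendre-surjective : ∀ {r s} → Prime r → r ≢ 2 → s ≡±1 → ∃[ d ] ¬ r ∣ d × legendre d r ≡ s
legendre-surjective pr _ (inj₁ refl) = 1 , prime-∤1 pr , legendre-1 pr
legendre-surjective {r} pr r≢2 (inj₂ refl) =
  let c , nqr = ∃-nonresidue (nonTrivial⇒n>1 r {{prime⇒nonTrivial pr}}) r-odd
  in c , (λ r∣c → nqr (isQR⁺ {c} {r} {0} (>-nonZero⁻¹ r {{prime⇒nonZero pr}}) (0≡c r∣c))) ,
     legendre-nonresidue {c} {r} nqr
  where
  r-odd : ¬ 2 ∣ r
  r-odd 2∣r = r≢2 (sym (prime-∣-prime prime[2] pr 2∣r))
  0≡c : ∀ {c} → r ∣ c → 0 mod r ≡ c mod r
  0≡c r∣c = trans (∣⇒mod≡0 r (r ∣0)) (sym (∣⇒mod≡0 r r∣c))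

-- The Jacobi symbol of a squarefree modulus

jacobiFactor : ℕ → ℕ → ℕ → ℕ → ℤ
jacobiFactor a n p k = if does (prime? p ×-dec (p ^ suc k ∣? n)) then legendre a p else 1ℤ

jacobi≡∏ : ∀ a n .{{_ : NonZero n}} → SquareFree n → jacobi a n ≡ ∏ (suc n) (λ p → jacobiFactor a n p 0)
jacobi≡∏ a n@(suc m) sf = begin
  jacobi a n
    ≡⟨ productℤ-concatMap-applyUpTo (λ p → map (jacobiFactor a n p) (upTo n)) id (suc n) ⟩
  ∏ (suc n) (λ p → productℤ (map (jacobiFactor a n p) (upTo n)))
    ≡⟨ ∏-cong (suc n) exponent-1 ⟩
  ∏ (suc n) (λ p → jacobiFactor a n p 0)
    ∎
  where
  higher-power-trivial : ∀ p k → jacobiFactor a n p (suc k) ≡ 1ℤ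
  higher-power-trivial p k with prime? p | p ^ suc (suc k) ∣? n
  ... | yes pp | yes p²⁺ᵏ∣n = contradiction (∣-trans (*-monoʳ-∣ p (m∣m*n (p ^ k))) p²⁺ᵏ∣n) (sf p pp)
  ... | yes _ | no _ = refl
  ... | no _ | _ = refl
  exponent-1 : ∀ p → productℤ (map (jacobiFactor a n p) (upTo n)) ≡ jacobiFactor a n p 0
  exponent-1 p = begin
    productℤ (map (jacobiFactor a n p) (upTo n))
      ≡⟨ productℤ-map-applyUpTo (jacobiFactor a n p) id n ⟩
    jacobiFactor a n p 0 ℤ.* ∏ m (jacobiFactor a n p ∘ suc)
      ≡⟨ cong (jacobiFactor a n p 0 ℤ.*_) (∏-ones m (higher-power-trivial p)) ⟩
    jacobiFactor a n p 0 ℤ.* 1ℤ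
      ≡⟨ ℤ.*-identityʳ _ ⟩
    jacobiFactor a n p 0
      ∎

jacobiFactor-cases : ∀ n p → (Prime p × p ∣ n × ∀ a → jacobiFactor a n p 0 ≡ legendre a p)
                           ⊎ (¬ (Prime p × p ∣ n) × ∀ a → jacobiFactor a n p 0 ≡ 1ℤ)
jacobiFactor-cases n p with prime? p | p ^ 1 ∣? n
... | yes pp | yes p¹∣n = inj₁ (pp , subst (_∣ n) (*-identityʳ p) p¹∣n , λ _ → refl)
... | yes _ | no p¹∤n = inj₂ ((λ (_ , p∣n) → p¹∤n (subst (_∣ n) (sym (*-identityʳ p)) p∣n)) , λ _ → refl)
... | no ¬pp | _ = inj₂ (¬pp ∘ proj₁ , λ _ → refl)

jacobiFactor≡±1 : ∀ a n p → jacobiFactor a n p 0 ≡±1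
jacobiFactor≡±1 a n p with jacobiFactor-cases n p
... | inj₁ (_ , _ , factor≡) = subst _≡±1 (sym (factor≡ a)) (legendre≡±1 a p)
... | inj₂ (_ , factor≡1) = inj₁ (factor≡1 a)

jacobi≡±1 : ∀ a n .{{_ : NonZero n}} → SquareFree n → jacobi a n ≡±1
jacobi≡±1 a n sf = subst _≡±1 (sym (jacobi≡∏ a n sf)) (∏-≡±1 (suc n) (jacobiFactor≡±1 a n))

jacobiCofactor : ℕ → ℕ → ℕ → ℤ
jacobiCofactor a n r = ∏ (suc n) ((λ p → jacobiFactor a n p 0) [ r ≔ 1ℤ ])

jacobi-split : ∀ {a n r} .{{_ : NonZero n}} → SquareFree n → Prime r → r ∣ n →
  jacobi a n ≡ legendre a r ℤ.* jacobiCofactor a n r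
jacobi-split {a} {n} {r} sf pr r∣n = begin
  jacobi a n
    ≡⟨ jacobi≡∏ a n sf ⟩
  ∏ (suc n) (λ p → jacobiFactor a n p 0)
    ≡⟨ ∏-split (suc n) (λ p → jacobiFactor a n p 0) (s≤s (∣⇒≤ r∣n)) ⟩
  jacobiFactor a n r 0 ℤ.* jacobiCofactor a n r
    ≡⟨ cong (ℤ._* jacobiCofactor a n r) factor≡legendre ⟩
  legendre a r ℤ.* jacobiCofactor a n r
    ∎
  where
  factor≡legendre : jacobiFactor a n r 0 ≡ legendre a r
  factor≡legendre with jacobiFactor-cases n r
  ... | inj₁ (_ , _ , factor≡) = factor≡ a
  ... | inj₂ (¬pr∣n , _) = contradiction (pr , r∣n) ¬pr∣n

jacobiCofactor-cong : ∀ {a b n r} → (∀ p → Prime p → p ∣ n → p ≢ r → legendre a p ≡ legendre b p) →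
  jacobiCofactor a n r ≡ jacobiCofactor b n r
jacobiCofactor-cong {a} {b} {n} {r} agree = ∏-cong (suc n) ([≔]-cong factors-agree)
  where
  factors-agree : ∀ p → p ≢ r → jacobiFactor a n p 0 ≡ jacobiFactor b n p 0
  factors-agree p p≢r with jacobiFactor-cases n p
  ... | inj₁ (pp , p∣n , factor≡) = trans (factor≡ a) (trans (agree p pp p∣n p≢r) (sym (factor≡ b)))
  ... | inj₂ (_ , factor≡1) = trans (factor≡1 a) (sym (factor≡1 b))

jacobiCofactor≡1 : ∀ {a n r} → (∀ p → Prime p → p ∣ n → p ≢ r → legendre a p ≡ 1ℤ) →
  jacobiCofactor a n r ≡ 1ℤ
jacobiCofactor≡1 {a} {n} {r} trivial = ∏-ones (suc n) ([≔]-elim (λ _ x → x ≡ 1ℤ) refl factor≡1)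
  where
  factor≡1 : ∀ p → p ≢ r → jacobiFactor a n p 0 ≡ 1ℤ
  factor≡1 p p≢r with jacobiFactor-cases n p
  ... | inj₁ (pp , p∣n , factor≡) = trans (factor≡ a) (trivial p pp p∣n p≢r)
  ... | inj₂ (_ , factor≡1) = factor≡1 a

jacobi≡legendre : ∀ {a n r} .{{_ : NonZero n}} → SquareFree n → Prime r → r ∣ n →
  (∀ p → Prime p → p ∣ n → p ≢ r → legendre a p ≡ 1ℤ) → jacobi a n ≡ legendre a r
jacobi≡legendre {a} {n} {r} sf pr r∣n trivial = begin
  jacobi a n                            ≡⟨ jacobi-split sf pr r∣n ⟩
  legendre a r ℤ.* jacobiCofactor a n r ≡⟨ cong (legendre a r ℤ.*_) (jacobiCofactor≡1 trivial) ⟩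
  legendre a r ℤ.* 1ℤ                   ≡⟨ ℤ.*-identityʳ _ ⟩
  legendre a r                          ∎

jacobi-neg : ∀ {a b n r} .{{_ : NonZero n}} → SquareFree n → Prime r → r ∣ n →
  (∀ p → Prime p → p ∣ n → p ≢ r → legendre a p ≡ legendre b p) →
  legendre a r ≡ ℤ.- legendre b r → jacobi a n ≡ ℤ.- jacobi b n
jacobi-neg {a} {b} {n} {r} sf pr r∣n agree flip = begin
  jacobi a n                                  ≡⟨ jacobi-split sf pr r∣n ⟩
  legendre a r ℤ.* jacobiCofactor a n r       ≡⟨ cong₂ ℤ._*_ flip (jacobiCofactor-cong agree) ⟩
  ℤ.- legendre b r ℤ.* jacobiCofactor b n r   ≡⟨ ℤ.neg-distribˡ-* (legendre b r) (jacobiCofactor b n r) ⟨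
  ℤ.- (legendre b r ℤ.* jacobiCofactor b n r) ≡⟨ cong ℤ.-_ (jacobi-split sf pr r∣n) ⟨
  ℤ.- jacobi b n                              ∎

-- Weighted sums modulo a prime

sumF-cong : ∀ l {f g : Fin l → ℕ} → (∀ k → f k ≡ g k) → sumF l f ≡ sumF l g
sumF-cong zero _ = refl
sumF-cong (suc l) f≡g = cong₂ _+_ (f≡g fzero) (sumF-cong l (f≡g ∘ fsuc))

sumF-mod : ∀ l q {f g : Fin l → ℕ} → (∀ k → f k mod q ≡ g k mod q) → sumF l f mod q ≡ sumF l g mod q
sumF-mod zero q _ = refl
sumF-mod (suc l) q f≡g = mod-+ q (f≡g fzero) (sumF-mod l q (f≡g ∘ fsuc))

sumF-*ˡ : ∀ l c (f : Fin l → ℕ) → sumF l (λ k → c * f k) ≡ c * sumF l f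
sumF-*ˡ zero c f = sym (*-zeroʳ c)
sumF-*ˡ (suc l) c f =
  trans (cong (c * f fzero +_) (sumF-*ˡ l c (f ∘ fsuc))) (sym (*-distribˡ-+ c (f fzero) _))

sumF-≔0 : ∀ l (f : Fin l → ℕ) c → sumF l f ≡ f c + sumF l (f [ c ≔ 0 ])
sumF-≔0 (suc l) f fzero = refl
sumF-≔0 (suc l) f (fsuc c) = begin
  f fzero + sumF l (f ∘ fsuc)
    ≡⟨ cong (f fzero +_) (sumF-≔0 l (f ∘ fsuc) c) ⟩
  f fzero + (f (fsuc c) + sumF l ((f ∘ fsuc) [ c ≔ 0 ]))
    ≡⟨ x∙yz≈y∙xz +-commutativeSemigroup (f fzero) (f (fsuc c)) _ ⟩
  f (fsuc c) + (f fzero + sumF l ((f ∘ fsuc) [ c ≔ 0 ]))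
    ∎

∃-zero-sum-weights : ∀ {q l} → Prime q → q ≢ 2 → (X : Fin l → ℕ) {c s : Fin l} →
  c ≢ s → ¬ q ∣ X c → ¬ q ∣ X s →
  ∃[ b ] (∀ k → ¬ q ∣ b k) × b c ≡ 1 × q ∣ sumF l (λ k → b k * X k)
∃-zero-sum-weights {q} {l} pq q≢2 X {c} {s} c≢s q∤Xc q∤Xs = b , q∤b , [≔]-updates b₀ c , q∣sum
  where
  D : ℕ
  D = sumF l ((X [ c ≔ 0 ]) [ s ≔ 0 ])
  -- q ∣ X c + D and q ∣ X c + 2 D together would give q ∣ D and then q ∣ X c.
  λΣ : ∃[ λ′ ] ¬ q ∣ λ′ × ¬ q ∣ X c + λ′ * D
  λΣ with q ∣? X c + 1 * D
  ... | no q∤ = 1 , prime-∤1 pq , q∤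
  ... | yes q∣Xc+D = 2 , q≢2 ∘ (λ q∣2 → prime-∣-prime pq prime[2] q∣2) , λ q∣Xc+2D →
    q∤Xc (∣m+n∣m⇒∣n (subst (q ∣_) (+-comm (X c) (1 * D)) q∣Xc+D)
      (∣m+n∣m⇒∣n (subst (q ∣_) (regroup (X c) D) q∣Xc+2D) q∣Xc+D))
    where
    regroup : ∀ x D → x + 2 * D ≡ (x + 1 * D) + 1 * D
    regroup = solve-∀
  λ′ = proj₁ λΣ
  μΣ : ∃[ μ ] q ∣ μ * X s + (X c + λ′ * D)
  μΣ = coprime⇒∣-solvable {{prime⇒nonZero pq}} (prime-∤⇒coprime pq q∤Xs) (X c + λ′ * D)
  μ = proj₁ μΣ
  b₀ b : Fin l → ℕ
  b₀ = (λ _ → λ′) [ s ≔ μ ]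
  b = b₀ [ c ≔ 1 ]
  q∤b : ∀ k → ¬ q ∣ b k
  q∤b = [≔]-elim (λ _ v → ¬ q ∣ v) (prime-∤1 pq)
          λ k _ → [≔]-elim (λ _ v → ¬ q ∣ v) q∤μ (λ _ _ → proj₁ (proj₂ λΣ)) k
    where
    q∤μ : ¬ q ∣ μ
    q∤μ q∣μ = proj₂ (proj₂ λΣ) (∣m+n∣m⇒∣n (proj₂ μΣ) (∣m⇒∣m*n (X s) q∣μ))
  b·X : Fin l → ℕ
  b·X k = b k * X k
  rest : ∀ k → ((b·X [ c ≔ 0 ]) [ s ≔ 0 ]) k ≡ λ′ * ((X [ c ≔ 0 ]) [ s ≔ 0 ]) k
  rest k with k ≟ s | k ≟ c
  ... | yes _ | _ = sym (*-zeroʳ λ′)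
  ... | no _ | yes _ = sym (*-zeroʳ λ′)
  ... | no _ | no _ = refl
  sum≡ : sumF l b·X ≡ X c + (μ * X s + λ′ * D)
  sum≡ = begin
    sumF l b·X
      ≡⟨ sumF-≔0 l b·X c ⟩
    b·X c + sumF l (b·X [ c ≔ 0 ])
      ≡⟨ cong (b·X c +_) (sumF-≔0 l (b·X [ c ≔ 0 ]) s) ⟩
    b·X c + ((b·X [ c ≔ 0 ]) s + sumF l ((b·X [ c ≔ 0 ]) [ s ≔ 0 ]))
      ≡⟨ cong₂ (λ u v → u + (v + sumF l ((b·X [ c ≔ 0 ]) [ s ≔ 0 ]))) b·X[c] b·X[s] ⟩
    X c + (μ * X s + sumF l ((b·X [ c ≔ 0 ]) [ s ≔ 0 ]))
      ≡⟨ cong (λ v → X c + (μ * X s + v))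
              (trans (sumF-cong l rest) (sumF-*ˡ l λ′ ((X [ c ≔ 0 ]) [ s ≔ 0 ]))) ⟩
    X c + (μ * X s + λ′ * D)
      ∎
    where
    b·X[c] : b·X c ≡ X c
    b·X[c] = trans (cong (_* X c) ([≔]-updates b₀ c)) (*-identityˡ (X c))
    b·X[s] : (b·X [ c ≔ 0 ]) s ≡ μ * X s
    b·X[s] = trans ([≔]-minimal {f = b·X} (c≢s ∘ sym))
      (cong (_* X s) (trans ([≔]-minimal {f = b₀} (c≢s ∘ sym)) ([≔]-updates (λ _ → λ′) s)))
  q∣sum : q ∣ sumF l b·X
  q∣sum = subst (q ∣_) (trans (x∙yz≈y∙xz +-commutativeSemigroup (μ * X s) (X c) (λ′ * D)) (sym sum≡))
                       (proj₂ μΣ)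

∃-zero-sum-weights-fixing : ∀ {q l} → Prime q → q ≢ 2 → (X : Fin l → ℕ) {i j : Fin l} →
  i ≢ j → ¬ q ∣ X i → ¬ q ∣ X j →
  {U : Fin l → Set} → Decidable U → (∀ k → U k → ¬ q ∣ X k) → (∀ k k′ → k ≢ k′ → U k → U k′ → ⊥) →
  ∃[ b ] (∀ k → ¬ q ∣ b k) × q ∣ sumF l (λ k → b k * X k) × (∀ k → U k → b k ≡ 1)
∃-zero-sum-weights-fixing {q} pq q≢2 X {i} {j} i≢j q∤Xi q∤Xj {U} U? q∤U unique with any? U?
... | no ∄U =
  let b , q∤b , _ , q∣sum = ∃-zero-sum-weights pq q≢2 X i≢j q∤Xi q∤Xj
  in b , q∤b , q∣sum , λ k Uk → contradiction (k , Uk) ∄U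
... | yes (c , Uc) =
  let s , c≢s , q∤Xs = other-index c
      b , q∤b , b[c]≡1 , q∣sum = ∃-zero-sum-weights pq q≢2 X c≢s (q∤U c Uc) q∤Xs
  in b , q∤b , q∣sum , λ k Uk → subst (λ k → b k ≡ 1) (sym (unique-U k Uk)) b[c]≡1
  where
  other-index : ∀ c → ∃[ s ] c ≢ s × ¬ q ∣ X s
  other-index c with i ≟ c
  ... | yes refl = j , i≢j , q∤Xj
  ... | no i≢c = i , i≢c ∘ sym , q∤Xi
  unique-U : ∀ k → U k → k ≡ c
  unique-U k Uk = decidable-stable (k ≟ c) λ k≢c → unique k c k≢c Uk Uc

decidable-choice : ∀ {A B : Set} {P : A → Set} {Q : A → B → Set} → B → Decidable P →
  (∀ a → P a → Σ B (Q a)) → Σ (A → B) λ f → ∀ a → P a → Q a (f a)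
decidable-choice {A} {B} {P} {Q} default P? choose = f , f-spec
  where
  f : A → B
  f a with P? a
  ... | yes Pa = proj₁ (choose a Pa)
  ... | no _ = default
  f-spec : ∀ a → P a → Q a (f a)
  f-spec a Pa with P? a
  ... | yes Pa′ = proj₂ (choose a Pa′)
  ... | no ¬Pa = contradiction Pa ¬Pa

∃-local-weights : ∀ {n n′ l} → ¬ 2 ∣ n → (X : Fin l → ℕ) →
  (∀ q → Prime q → q ∣ n → Σ (Fin l) λ i → Σ (Fin l) λ j → i ≢ j × Coprime (X i) q × Coprime (X j) q) →
  (∀ i j → i ≢ j → Coprime (X i mod n′) n′ → Coprime (X j mod n′) n′ → ⊥) →
  ∃[ b ] ∀ q → Prime q → q ∣ n → (∀ k → ¬ q ∣ b q k) × q ∣ sumF l (λ k → b q k * X k) ×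
                                 (∀ k → q ∣ n′ × Coprime (X k mod n′) n′ → b q k ≡ 1)
∃-local-weights {n} {n′} {l} n-odd X two-coprime units-unique =
  let b , b-local = decidable-choice (λ _ → 0) (λ q → prime? q ×-dec q ∣? n) local
  in b , λ q pq q∣n → b-local q (pq , q∣n)
  where
  local : ∀ q → Prime q × q ∣ n → ∃[ b ] (∀ k → ¬ q ∣ b k) × q ∣ sumF l (λ k → b k * X k) ×
                                          (∀ k → q ∣ n′ × Coprime (X k mod n′) n′ → b k ≡ 1)
  local q (pq , q∣n) =
    let i , j , i≢j , i-coprime , j-coprime = two-coprime q pq q∣n
    in ∃-zero-sum-weights-fixing pq (λ { refl → n-odd q∣n }) X i≢j
         (coprime⇒∤ i-coprime pq ∣-refl) (coprime⇒∤ j-coprime pq ∣-refl)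
         (λ k → q ∣? n′ ×-dec coprime? (X k mod n′) n′)
         (λ k (q∣n′ , unit) → coprime⇒∤ unit pq q∣n′ ∘ ∣⇒∣-mod n′ q∣n′)
         (λ k k′ k≢k′ (_ , unit) (_ , unit′) → units-unique k k′ k≢k′ unit unit′)

-- Lifting local weights to elements of L(n;p′)

∃-unit-lift : ∀ {n} .{{_ : NonZero n}} → SquareFree n →
  (b : ℕ → ℕ) → (∀ q → Prime q → q ∣ n → ¬ q ∣ b q) →
  ∃[ w ] U n w × ∀ q → Prime q → q ∣ n → w mod q ≡ b q mod q
∃-unit-lift {n} sf b q∤b =
  let w , w<n , w≡b = chinese-remainder n sf b
  in w , (w<n , ∤⇒coprime λ q pq q∣n q∣w → q∤b q pq q∣n (∣-resp-mod q (sym (w≡b q pq q∣n)) q∣w)) , w≡b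

∃-L-lift : ∀ {n p′} .{{_ : NonZero n}} → SquareFree n → Prime p′ → p′ ∣ n →
  (b : ℕ → ℕ) → (∀ q → Prime q → q ∣ n → ¬ q ∣ b q) → (∀ q → Prime q → q ∣ n → q ≢ p′ → b q ≡ 1) →
  ∃[ w ] L n p′ w × ∀ q → Prime q → q ∣ n → w mod q ≡ b q mod q
∃-L-lift sf pp′ p′∣n b q∤b b≡1 =
  let w , w∈U , w≡b = ∃-unit-lift sf b q∤b
      legendre≡1 q pq q∣n q≢p′ =
        trans (legendre-cong q (trans (w≡b q pq q∣n) (cong (_mod q) (b≡1 q pq q∣n q≢p′)))) (legendre-1 pq)
  in w , (w∈U , jacobi≡legendre sf pp′ p′∣n legendre≡1) , w≡b

∃-legendre-flip : ∀ {n r w} .{{_ : NonZero n}} → SquareFree n → Prime r → r ∣ n → r ≢ 2 → Coprime w n →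
  ∃[ w′ ] U n w′ × (∀ q → Prime q → q ∣ n → q ≢ r → w′ mod q ≡ w mod q) ×
           legendre w′ r ≡ ℤ.- legendre w r
∃-legendre-flip {n} {r} {w} sf pr r∣n r≢2 w-coprime =
  w′ , w′∈U , (λ q pq q∣n q≢r → trans (w′≡residue q pq q∣n) (cong (_mod q) ([≔]-minimal q≢r))) ,
  legendre-w′
  where
  dΣ = legendre-surjective pr r≢2 (neg-≡±1 (legendre≡±1 w r))
  d = proj₁ dΣ
  residue : ℕ → ℕ
  residue = (λ _ → w) [ r ≔ d ]
  q∤residue : ∀ q → Prime q → q ∣ n → ¬ q ∣ residue q
  q∤residue = [≔]-elim (λ q v → Prime q → q ∣ n → ¬ q ∣ v) (λ _ _ → proj₁ (proj₂ dΣ))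
                (λ q _ → coprime⇒∤ w-coprime)
  w′Σ = ∃-unit-lift sf residue q∤residue
  w′ = proj₁ w′Σ
  w′∈U = proj₁ (proj₂ w′Σ)
  w′≡residue = proj₂ (proj₂ w′Σ)
  legendre-w′ : legendre w′ r ≡ ℤ.- legendre w r
  legendre-w′ = begin
    legendre w′ r          ≡⟨ legendre-cong r (w′≡residue r pr r∣n) ⟩
    legendre (residue r) r ≡⟨ cong (λ v → legendre v r) ([≔]-updates (λ _ → w) r) ⟩
    legendre d r           ≡⟨ proj₂ (proj₂ dΣ) ⟩
    ℤ.- legendre w r       ∎

∃-L-lift-except : ∀ {n p′ r} .{{_ : NonZero n}} → SquareFree n → Prime p′ → p′ ∣ n →
  Prime r → r ∣ n → r ≢ 2 → r ≢ p′ → (b : ℕ → ℕ) → (∀ q → Prime q → q ∣ n → ¬ q ∣ b q) →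
  ∃[ w ] L n p′ w × ∀ q → Prime q → q ∣ n → q ≢ r → w mod q ≡ b q mod q
∃-L-lift-except {n} {p′} sf pp′ p′∣n pr r∣n r≢2 r≢p′ b q∤b
  with w , w∈U , w≡b ← ∃-unit-lift sf b q∤b
  with jacobi w n ℤ.≟ legendre w p′
... | yes w∈L = w , (w∈U , w∈L) , λ q pq q∣n _ → w≡b q pq q∣n
... | no w∉L with w′ , w′∈U , w′≡w , flip ← ∃-legendre-flip sf pr r∣n r≢2 (proj₂ w∈U) =
  w′ , (w′∈U , w′∈L) , λ q pq q∣n q≢r → trans (w′≡w q pq q∣n q≢r) (w≡b q pq q∣n)
  where
  w′∈L : jacobi w′ n ≡ legendre w′ p′
  w′∈L = begin
    jacobi w′ n             ≡⟨ jacobi-neg sf pr r∣n (λ p pp p∣n p≢r → legendre-cong p (w′≡w p pp p∣n p≢r))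
                                          flip ⟩
    ℤ.- jacobi w n          ≡⟨ cong ℤ.-_ (≢⇒≡neg (jacobi≡±1 w n sf) (legendre≡±1 w p′) w∉L) ⟩
    ℤ.- (ℤ.- legendre w p′) ≡⟨ ℤ.neg-involutive _ ⟩
    legendre w p′           ≡⟨ legendre-cong p′ (w′≡w p′ pp′ p′∣n (r≢p′ ∘ sym)) ⟨
    legendre w′ p′          ∎

∃-L-weight : ∀ {n p′ n′} → ¬ 2 ∣ n → SquareFree n → Prime p′ → n ≡ n′ * p′ →
  (b : ℕ → ℕ) → (∀ q → Prime q → q ∣ n → ¬ q ∣ b q) → (x : ℕ) →
  (Coprime (x mod n′) n′ → ∀ q → Prime q → q ∣ n′ → b q ≡ 1) →
  ∃[ w ] L n p′ w × ∀ q → Prime q → q ∣ n → (w * x) mod q ≡ (b q * x) mod q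
∃-L-weight {n} {p′} {n′} n-odd sf pp′ n≡n′p′ b q∤b x unit⇒b≡1 = weight (coprime? (x mod n′) n′)
  where
  instance
    n≢0 : NonZero n
    n≢0 = odd⇒nonZero n-odd
    n′≢0 : NonZero n′
    n′≢0 = m*n≢0⇒m≢0 n′ {{subst NonZero n≡n′p′ n≢0}}
  p′∣n : p′ ∣ n
  p′∣n = divides n′ n≡n′p′
  ∣n′⇒∣n : ∀ {q} → q ∣ n′ → q ∣ n
  ∣n′⇒∣n q∣n′ = ∣-trans q∣n′ (divides p′ (trans n≡n′p′ (*-comm n′ p′)))
  p′∤n′ : ¬ p′ ∣ n′
  p′∤n′ p′∣n′ = sf p′ pp′ (subst (p′ * p′ ∣_) (sym n≡n′p′) (*-pres-∣ p′∣n′ ∣-refl))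
  odd-prime : ∀ {q} → q ∣ n → q ≢ 2
  odd-prime q∣n refl = n-odd q∣n
  weight : Dec (Coprime (x mod n′) n′) →
    ∃[ w ] L n p′ w × ∀ q → Prime q → q ∣ n → (w * x) mod q ≡ (b q * x) mod q
  weight (yes unit) =
    let w , w∈L , w≡b = ∃-L-lift sf pp′ p′∣n b q∤b λ q pq q∣n q≢p′ →
                          unit⇒b≡1 unit q pq (∣m*p⇒∣m pq pp′ q≢p′ (subst (q ∣_) n≡n′p′ q∣n))
    in w , w∈L , λ q pq q∣n → mod-*ʳ q x (w≡b q pq q∣n)
  weight (no nonunit)
    with r , pr , r∣n′ , r∣x%n′ ← ¬coprime⇒∃-prime nonunit
    with w , w∈L , w≡b ← ∃-L-lift-except sf pp′ p′∣n pr (∣n′⇒∣n r∣n′) (odd-prime (∣n′⇒∣n r∣n′))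
                            (λ { refl → p′∤n′ r∣n′ }) b q∤b = w , w∈L , w*x≡b*x
    where
    w*x≡b*x : ∀ q → Prime q → q ∣ n → (w * x) mod q ≡ (b q * x) mod q
    w*x≡b*x q pq q∣n with q ≟ r
    ... | no q≢r = mod-*ʳ q x (w≡b q pq q∣n q≢r)
    ... | yes refl = trans (∣⇒mod≡0 q (∣n⇒∣m*n w r∣x)) (sym (∣⇒mod≡0 q (∣n⇒∣m*n (b q) r∣x)))
      where
      r∣x = ∣-mod⇒∣ n′ r∣n′ r∣x%n′

lemma3p6 : (n p' : ℕ) → ¬ (2 ∣ n) → SquareFree n → Prime p' →
    (n' : ℕ) → n ≡ n' * p' →
    (l : ℕ) → (x : Fin l → Fin n) →
    ((p : ℕ) → Prime p → p ∣ n →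
      Σ (Fin l) λ i → Σ (Fin l) λ j → ¬ (i ≡ j) × Coprime (toℕ (x i)) p × Coprime (toℕ (x j)) p) →
    ((i j : Fin l) → ¬ (i ≡ j) →
      Coprime (toℕ (x i) mod n') n' → Coprime (toℕ (x j) mod n') n' → ⊥) →
    WeightedZeroSum n (L n p') l x
lemma3p6 n p' n-odd sf pp' n' n≡n'p' l x two-coprime units-unique =
  w , (λ i → proj₁ (proj₂ (term i))) , ∣⇒mod≡0 n (primes-∣⇒∣ n sf q∣sum)
  where
  instance
    n≢0 : NonZero n
    n≢0 = odd⇒nonZero n-odd
  X : Fin l → ℕ
  X k = toℕ (x k)
  local = ∃-local-weights n-odd X two-coprime units-unique
  b = proj₁ local
  term : ∀ i → ∃[ w ] L n p' w × ∀ q → Prime q → q ∣ n → (w * X i) mod q ≡ (b q i * X i) mod q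
  term i = ∃-L-weight n-odd sf pp' n≡n'p' (λ q → b q i) (λ q pq q∣n → proj₁ (proj₂ local q pq q∣n) i) (X i)
    λ unit q pq q∣n' → proj₂ (proj₂ (proj₂ local q pq (∣-trans q∣n' (divides p' (trans n≡n'p' (*-comm n' p'))))))
                         i (q∣n' , unit)
  w : Fin l → ℕ
  w i = proj₁ (term i)
  q∣sum : ∀ q → Prime q → q ∣ n → q ∣ sumF l (λ i → w i * X i)
  q∣sum q pq q∣n =
    ∣-resp-mod q (sumF-mod l q λ i → proj₂ (proj₂ (term i)) q pq q∣n) (proj₁ (proj₂ (proj₂ local q pq q∣n)))
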